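{- Consider the PDSTSP setting described in the context. Let $H \subseteq V_c$, $H' \subseteq H$ and $E' \subset E$ satisfy: (1) $|H'| \geq 3$ and $|H'|$ is odd; (2) exactly one endpoint of each edge in $E'$ lies in $H'$, and each vertex of $H'$ is an endpoint of a single edge in $E'$; (3) no edge in $E'$ has both endpoints in $H$; (4) no two different edges in $E'$ share an endpoint. Then every feasible PDSTSP solution $(x,y)$ satisfies $$\sum_{i, j \in H:\, i<j} x_{ij} + \sum_{(i, j) \in E'} x_{ij} \leq \sum_{j \in H} y_j + \frac{1}{2}\left(|H'| - 1\right).$$
   Context: Parallel Drone Scheduling Traveling Salesman Problem (PDSTSP). There is a complete undirected graph $G=(V,E)$ with $V=\{0,1,\dots,n,n+1\}$ and $E=\{(i,j): i,j\in V,\ i<j\}$. Vertex $0$ is the depot and vertex $n+1$ is a copy of the depot. The customers are $V_c=\{1,\dots,n\}$. A subset $V_d\subseteq V_c$ consists of drone-eligible customers, and $V_t=V_c\setminus V_d$ are the customers that must be served by the truck. The variables are binary $x_{ij}$ for edges $(i,j)\in E$ (equal to 1 if the truck travels edge $(i,j)$) and binary $y_i$ for $i \in V$ (equal to 1 if vertex $i$ is visited by the truck), with $y_0=y_{n+1}=1$. Each customer with $y_i=0$ is served by one of the drones via back-and-forth trips from the depot; the drone variables are irrelevant here. A pair $(x,y)$ is a feasible PDSTSP solution if: $y_i=1$ for all $i\in V_t$; and $x$ is the incidence vector of the edge set of a simple path in $G$ from $0$ to $n+1$ whose interior vertices are exactly the customers $i\in V_c$ with $y_i=1$. In particular, every customer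 $j$ satisfies $\sum_{i<j}x_{ij}+\sum_{k>j}x_{jk}=2y_j$. -}

module Defs where

open import Data.Nat using (ℕ; zero; suc; _+_; _<_; _<ᵇ_)
open import Data.Fin using (Fin; toℕ; fromℕ)
open import Data.Bool using (Bool; true; false; if_then_else_; _∧_)
open import Data.List using (List; []; _∷_; _++_; [_]; allFin; map)
open import Data.Nat.ListAction using (sum)
open import Data.List.Membership.Propositional using (_∈_)
open import Data.List.Relation.Unary.Unique.Propositional using (Unique)
open import Data.Product using (Σ; _×_; _,_)
open import Data.Sum using (_⊎_)
open import Relation.Binary.PropositionalEquality using (_≡_)
open import Relation.Nullary using (¬_)

-- Vertex set V = {0,...,n+1} is Fin (2 + n); vertex 0 = depot, n+1 = depot copy.
Vtx : ℕ → Set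
Vtx n = Fin (suc (suc n))

depot : ∀ {n} → Vtx n
depot = Data.Fin.zero

depot' : ∀ {n} → Vtx n
depot' {n} = fromℕ (suc n)

IsCustomer : ∀ {n} → Vtx n → Set
IsCustomer {n} v = (0 < toℕ v) × (toℕ v < suc n)

data Consecutive {A : Set} : List A → A → A → Set where
  here  : ∀ {a b l} → Consecutive (a ∷ b ∷ l) a b
  there : ∀ {a b c l} → Consecutive l a b → Consecutive (c ∷ l) a b

Adj : ∀ {A : Set} → List A → A → A → Set
Adj p i j = Consecutive p i j ⊎ Consecutive p j i

-- Feasible PDSTSP solution (x,y); Vd = drone-eligible customers (as a Bool predicate).
-- x i j is only meaningful for toℕ i < toℕ j.
record Feasible (n : ℕ) (Vd : Vtx n → Bool)
                (x : Vtx n → Vtx n → ℕ) (y : Vtx n → ℕ) : Set where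
  field
    interior   : List (Vtx n)
    simple     : Unique (depot ∷ interior ++ [ depot' ])
    y-binary   : ∀ v → (y v ≡ 0) ⊎ (y v ≡ 1)
    y-depot    : y depot ≡ 1
    y-depot'   : y depot' ≡ 1
    y-truck    : ∀ v → IsCustomer v → Vd v ≡ false → y v ≡ 1
    interior-y : ∀ v → IsCustomer v → (y v ≡ 1 → v ∈ interior) × (v ∈ interior → y v ≡ 1)
    x-path     : ∀ i j → toℕ i < toℕ j →
                 ((x i j ≡ 1) × Adj (depot ∷ interior ++ [ depot' ]) i j)
                 ⊎ ((x i j ≡ 0) × ¬ Adj (depot ∷ interior ++ [ depot' ]) i j)

sumV : ∀ {m} → (Fin m → Bool) → (Fin m → ℕ) → ℕ
sumV {m} P f = sum (map (λ v → if P v then f v else 0) (allFin m))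

card : ∀ {m} → (Fin m → Bool) → ℕ
card P = sumV P (λ _ → 1)

sumE : ∀ {m} → (Fin m → Fin m → Bool) → (Fin m → Fin m → ℕ) → ℕ
sumE {m} P f = sum (map (λ i → sum (map (λ j →
  if (toℕ i <ᵇ toℕ j) ∧ P i j then f i j else 0) (allFin m))) (allFin m))

-- Write x(S) for the x-weight of an edge set S. A customer j has truck degree at most 2 y_j,
-- since a simple path gives each vertex at most two neighbours. Summing degrees over H counts
-- every edge inside H twice and every edge of E′ once, since it has exactly one end in H (its
-- end in H′ ⊆ H): 2 x(E(H)) + x(E′) ≤ 2 y(H). As E′ is a matching whose edges all meet H′,
-- also x(E′) ≤ |H′| = 2k + 1. Adding gives 2 (x(E(H)) + x(E′)) ≤ 2 (y(H) + k) + 1, and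
-- integrality removes the final 1.

module Submission where

open import Defs
open import Data.Nat using (ℕ; zero; suc; _+_; _∸_; _/_; _≤_; _<_; _*_; z≤n; s≤s; _<ᵇ_)
open import Data.Nat.Properties
  using (module ≤-Reasoning; +-0-commutativeMonoid; +-mono-≤; +-monoʳ-≤; +-suc; ≤-pred; ≤-refl;
         ≤-reflexive; <-irrefl; <-asym; +-identityʳ; <ᵇ-reflects-<; m+n∸n≡m; *-comm)
open import Data.Nat.DivMod using (m*n/n≡m)
open import Data.Nat.Tactic.RingSolver using (solve)
open import Data.Nat.ListAction using (sum)
open import Data.Fin using (Fin; toℕ)
import Data.Fin as Fin
open import Data.Fin.Properties using (suc-injective; toℕ-fromℕ; <⇒≢) renaming (_≟_ to _≟ᶠ_)
open import Data.Bool using (Bool; true; false; _∧_; if_then_else_)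
open import Data.List using (List; []; _∷_; _++_; [_]; map; allFin; tabulate)
open import Data.List.Properties using (map-tabulate)
open import Data.List.Membership.Propositional using (_∈_; _∉_)
open import Data.List.Membership.Propositional.Properties using (∈-++⁻)
open import Data.List.Relation.Unary.Any using (here; there)
open import Data.List.Relation.Unary.All using () renaming (lookup to All-lookup)
open import Data.List.Relation.Unary.AllPairs using (_∷_)
open import Data.List.Relation.Unary.Unique.Propositional using (Unique)
open import Data.Product using (_×_; _,_; ∃; proj₁; proj₂)
open import Data.Sum using (_⊎_; inj₁; inj₂)
open import Data.Empty using (⊥-elim)
open import Function using (_∘_; id)
open import Relation.Nullary using (¬_; yes; no)
open import Relation.Nullary.Reflects using (ofʸ)
open import Relation.Binary.PropositionalEquality
  using (_≡_; _≢_; ≢-sym; refl; sym; trans; cong; cong₂; subst; module ≡-Reasoning)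
open import Algebra.Properties.CommutativeMonoid.Sum +-0-commutativeMonoid
  using (sum-syntax; sum-cong-≗; sum-replicate-zero; ∑-distrib-+; ∑-comm)

∑∑ : ∀ {m} → (Fin m → Fin m → ℕ) → ℕ
∑∑ {m} w = ∑[ i < m ] ∑[ j < m ] w i j

∑-mono-≤ : ∀ {m} {f g : Fin m → ℕ} → (∀ i → f i ≤ g i) → ∑[ i < m ] f i ≤ ∑[ i < m ] g i
∑-mono-≤ {zero}  f≤g = z≤n
∑-mono-≤ {suc m} f≤g = +-mono-≤ (f≤g Fin.zero) (∑-mono-≤ (f≤g ∘ Fin.suc))

∑∑-mono-≤ : ∀ {m} {v w : Fin m → Fin m → ℕ} → (∀ i j → v i j ≤ w i j) → ∑∑ v ≤ ∑∑ w
∑∑-mono-≤ v≤w = ∑-mono-≤ (∑-mono-≤ ∘ v≤w)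

∑∑-distrib-+ : ∀ {m} (v w : Fin m → Fin m → ℕ) → ∑∑ (λ i j → v i j + w i j) ≡ ∑∑ v + ∑∑ w
∑∑-distrib-+ {m} v w =
  trans (sum-cong-≗ (λ i → ∑-distrib-+ (v i) (w i)))
        (∑-distrib-+ (λ i → ∑[ j < m ] v i j) (λ i → ∑[ j < m ] w i j))

sum-tabulate : ∀ {m} (f : Fin m → ℕ) → sum (tabulate f) ≡ ∑[ i < m ] f i
sum-tabulate {zero}  f = refl
sum-tabulate {suc m} f = cong (f Fin.zero +_) (sum-tabulate (f ∘ Fin.suc))

sum-map-allFin : ∀ {m} (f : Fin m → ℕ) → sum (map f (allFin m)) ≡ ∑[ i < m ] f i
sum-map-allFin f = trans (cong sum (map-tabulate id f)) (sum-tabulate f)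

∑-if : ∀ {m} (b : Bool) (f : Fin m → ℕ) →
  ∑[ j < m ] (if b then f j else 0) ≡ (if b then ∑[ j < m ] f j else 0)
∑-if         true  f = refl
∑-if {m = m} false f = sum-replicate-zero m

if-+ : ∀ (b : Bool) p q → (if b then p else 0) + (if b then q else 0) ≡ (if b then p + q else 0)
if-+ true  p q = refl
if-+ false p q = refl

if-mono-≤ : ∀ (b : Bool) {p q} → (b ≡ true → p ≤ q) → (if b then p else 0) ≤ (if b then q else 0)
if-mono-≤ true  p≤q = p≤q refl
if-mono-≤ false p≤q = z≤n

sumV-as-∑ : ∀ {m} (P : Fin m → Bool) (f : Fin m → ℕ) → sumV P f ≡ ∑[ v < m ] (if P v then f v else 0)
sumV-as-∑ P f = sum-map-allFin (λ v → if P v then f v else 0)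

onEdges : ∀ {m} → (Fin m → Fin m → Bool) → (Fin m → Fin m → ℕ) → Fin m → Fin m → ℕ
onEdges P w i j = if (toℕ i <ᵇ toℕ j) ∧ P i j then w i j else 0

sumE-as-∑∑ : ∀ {m} (P : Fin m → Fin m → Bool) (w : Fin m → Fin m → ℕ) → sumE P w ≡ ∑∑ (onEdges P w)
sumE-as-∑∑ {m} P w =
  trans (sum-map-allFin (λ i → sum (map (onEdges P w i) (allFin m))))
        (sum-cong-≗ (λ i → sum-map-allFin (onEdges P w i)))

degree : ∀ {m} → (Fin m → Fin m → ℕ) → Fin m → ℕ
degree {m} w v = ∑[ j < m ] w v j + ∑[ i < m ] w i v

∑∑-ends≡∑-degree : ∀ {m} (A : Fin m → Bool) (w : Fin m → Fin m → ℕ) →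
  ∑∑ (λ i j → (if A i then w i j else 0) + (if A j then w i j else 0))
  ≡ ∑[ v < m ] (if A v then degree w v else 0)
∑∑-ends≡∑-degree {m} A w = begin
  ∑∑ (λ i j → (if A i then w i j else 0) + (if A j then w i j else 0))
    ≡⟨ ∑∑-distrib-+ (λ i j → if A i then w i j else 0) (λ i j → if A j then w i j else 0) ⟩
  ∑∑ (λ i j → if A i then w i j else 0) + ∑∑ (λ i j → if A j then w i j else 0)
    ≡⟨ cong₂ _+_ (sum-cong-≗ (λ i → ∑-if (A i) (w i)))
                 (trans (∑-comm (λ i j → if A j then w i j else 0))
                        (sum-cong-≗ (λ j → ∑-if (A j) (λ i → w i j)))) ⟩
  ∑[ v < m ] (if A v then out v else 0) + ∑[ v < m ] (if A v then in' v else 0)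
    ≡⟨ sym (∑-distrib-+ (λ v → if A v then out v else 0) (λ v → if A v then in' v else 0)) ⟩
  ∑[ v < m ] ((if A v then out v else 0) + (if A v then in' v else 0))
    ≡⟨ sum-cong-≗ (λ v → if-+ (A v) (out v) (in' v)) ⟩
  ∑[ v < m ] (if A v then degree w v else 0) ∎
  where
  open ≡-Reasoning
  out in' : Fin m → ℕ
  out v = ∑[ j < m ] w v j
  in' v = ∑[ i < m ] w i v

Indicator : ∀ {m} → (Fin m → ℕ) → (Fin m → Set) → Set
Indicator h P = ∀ u → h u ≡ 0 ⊎ (h u ≡ 1 × P u)

AtMostOne : {A : Set} → (A → Set) → Set
AtMostOne P = ∀ a b → P a → P b → a ≡ b

AtMostTwo : {A : Set} → (A → Set) → Set
AtMostTwo P = ∀ a b c → P a → P b → P c → a ≡ b ⊎ a ≡ c ⊎ b ≡ c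

∑-indicator-≤0 : ∀ {m} {h : Fin m → ℕ} {P} → Indicator h P → (∀ u → ¬ P u) → ∑[ u < m ] h u ≤ 0
∑-indicator-≤0 {zero}  ind ¬P = z≤n
∑-indicator-≤0 {suc m} ind ¬P with ind Fin.zero
... | inj₁ h₀≡0 rewrite h₀≡0 = ∑-indicator-≤0 (ind ∘ Fin.suc) (¬P ∘ Fin.suc)
... | inj₂ (_ , P₀) = ⊥-elim (¬P Fin.zero P₀)

∑-indicator-≤1 : ∀ {m} {h : Fin m → ℕ} {P} → Indicator h P → AtMostOne P → ∑[ u < m ] h u ≤ 1
∑-indicator-≤1 {zero}  ind one = z≤n
∑-indicator-≤1 {suc m} ind one with ind Fin.zero
... | inj₁ h₀≡0 rewrite h₀≡0 =
  ∑-indicator-≤1 (ind ∘ Fin.suc) (λ a b Pa Pb → suc-injective (one _ _ Pa Pb))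
... | inj₂ (h₀≡1 , P₀) rewrite h₀≡1 =
  +-monoʳ-≤ 1 (∑-indicator-≤0 (ind ∘ Fin.suc) (λ a Pa → zero≢suc (one _ _ P₀ Pa)))
  where
  zero≢suc : ∀ {a : Fin m} → Fin.zero ≢ Fin.suc a
  zero≢suc ()

∑-indicator-≤2 : ∀ {m} {h : Fin m → ℕ} {P} → Indicator h P → AtMostTwo P → ∑[ u < m ] h u ≤ 2
∑-indicator-≤2 {zero}  ind two = z≤n
∑-indicator-≤2 {suc m} {P = P} ind two with ind Fin.zero
... | inj₁ h₀≡0 rewrite h₀≡0 = ∑-indicator-≤2 (ind ∘ Fin.suc) two′
  where
  two′ : AtMostTwo (P ∘ Fin.suc)
  two′ a b c Pa Pb Pc with two _ _ _ Pa Pb Pc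
  ... | inj₁ a≡b        = inj₁ (suc-injective a≡b)
  ... | inj₂ (inj₁ a≡c) = inj₂ (inj₁ (suc-injective a≡c))
  ... | inj₂ (inj₂ b≡c) = inj₂ (inj₂ (suc-injective b≡c))
... | inj₂ (h₀≡1 , P₀) rewrite h₀≡1 = +-monoʳ-≤ 1 (∑-indicator-≤1 (ind ∘ Fin.suc) one)
  where
  one : AtMostOne (P ∘ Fin.suc)
  one a b Pa Pb with two _ _ _ P₀ Pa Pb
  ... | inj₁ ()
  ... | inj₂ (inj₁ ())
  ... | inj₂ (inj₂ a≡b) = suc-injective a≡b

EdgeIndicator : ∀ {m} → (Fin m → Fin m → ℕ) → (Fin m → Fin m → Set) → Set
EdgeIndicator w R = ∀ i j → w i j ≡ 0 ⊎ (w i j ≡ 1 × toℕ i < toℕ j × R i j)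

Incident : ∀ {m} → (Fin m → Fin m → Set) → Fin m → Fin m → Set
Incident R v u = (toℕ v < toℕ u × R v u) ⊎ (toℕ u < toℕ v × R u v)

degree-indicator : ∀ {m} {w : Fin m → Fin m → ℕ} {R} → EdgeIndicator w R →
  ∀ v → Indicator (λ u → w v u + w u v) (Incident R v)
degree-indicator {w = w} ind v u with w v u | w u v | ind v u | ind u v
... | _ | _ | inj₁ refl             | inj₁ refl             = inj₁ refl
... | _ | _ | inj₁ refl             | inj₂ (refl , u<v , R) = inj₂ (refl , inj₂ (u<v , R))
... | _ | _ | inj₂ (refl , v<u , R) | inj₁ refl             = inj₂ (refl , inj₁ (v<u , R))
... | _ | _ | inj₂ (_ , v<u , _)    | inj₂ (_ , u<v , _)    = ⊥-elim (<-asym v<u u<v)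

degree-≤0 : ∀ {m} {w : Fin m → Fin m → ℕ} {R} → EdgeIndicator w R →
  ∀ v → (∀ u → ¬ Incident R v u) → degree w v ≤ 0
degree-≤0 {w = w} ind v isolated =
  subst (_≤ 0) (∑-distrib-+ (w v) (λ u → w u v)) (∑-indicator-≤0 (degree-indicator ind v) isolated)

degree-≤1 : ∀ {m} {w : Fin m → Fin m → ℕ} {R} → EdgeIndicator w R →
  ∀ v → AtMostOne (Incident R v) → degree w v ≤ 1
degree-≤1 {w = w} ind v one =
  subst (_≤ 1) (∑-distrib-+ (w v) (λ u → w u v)) (∑-indicator-≤1 (degree-indicator ind v) one)

degree-≤2 : ∀ {m} {w : Fin m → Fin m → ℕ} {R} → EdgeIndicator w R →
  ∀ v → AtMostTwo (Incident R v) → degree w v ≤ 2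
degree-≤2 {w = w} ind v two =
  subst (_≤ 2) (∑-distrib-+ (w v) (λ u → w u v)) (∑-indicator-≤2 (degree-indicator ind v) two)

module _ {A : Set} where

  Consecutive⇒∈ˡ : ∀ {l : List A} {a b} → Consecutive l a b → a ∈ l
  Consecutive⇒∈ˡ here      = here refl
  Consecutive⇒∈ˡ (there c) = there (Consecutive⇒∈ˡ c)

  Consecutive⇒∈ʳ : ∀ {l : List A} {a b} → Consecutive l a b → b ∈ l
  Consecutive⇒∈ʳ here      = there (here refl)
  Consecutive⇒∈ʳ (there c) = there (Consecutive⇒∈ʳ c)

  Consecutive⇒∈ʳ-tail : ∀ {c} {l : List A} {a b} → Consecutive (c ∷ l) a b → b ∈ l
  Consecutive⇒∈ʳ-tail here      = here refl
  Consecutive⇒∈ʳ-tail (there c) = Consecutive⇒∈ʳ c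

  Consecutive-next-unique : ∀ {l : List A} {v a b} → Unique l →
    Consecutive l v a → Consecutive l v b → a ≡ b
  Consecutive-next-unique u          here       here       = refl
  Consecutive-next-unique (v∉ ∷ _)   here       (there c)  = ⊥-elim (All-lookup v∉ (Consecutive⇒∈ˡ c) refl)
  Consecutive-next-unique (v∉ ∷ _)   (there c)  here       = ⊥-elim (All-lookup v∉ (Consecutive⇒∈ˡ c) refl)
  Consecutive-next-unique (_ ∷ u)    (there c)  (there c′) = Consecutive-next-unique u c c′

  Consecutive-prev-unique : ∀ {l : List A} {v a b} → Unique l →
    Consecutive l a v → Consecutive l b v → a ≡ b
  Consecutive-prev-unique u               here      here       = refl
  Consecutive-prev-unique (_ ∷ (v∉ ∷ _))  here      (there c)  =
    ⊥-elim (All-lookup v∉ (Consecutive⇒∈ʳ-tail c) refl)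
  Consecutive-prev-unique (_ ∷ (v∉ ∷ _))  (there c) here       =
    ⊥-elim (All-lookup v∉ (Consecutive⇒∈ʳ-tail c) refl)
  Consecutive-prev-unique (_ ∷ u)         (there c) (there c′) = Consecutive-prev-unique u c c′

  Adj-sym : ∀ {l : List A} {a b} → Adj l a b → Adj l b a
  Adj-sym (inj₁ c) = inj₂ c
  Adj-sym (inj₂ c) = inj₁ c

  Adj⇒∈ : ∀ {l : List A} {a b} → Adj l a b → a ∈ l
  Adj⇒∈ (inj₁ c) = Consecutive⇒∈ˡ c
  Adj⇒∈ (inj₂ c) = Consecutive⇒∈ʳ c

  -- Among any three neighbours of v, two are on the same side of v.
  Adj-atMostTwo : ∀ {l : List A} {v} → Unique l → AtMostTwo (Adj l v)
  Adj-atMostTwo u a b c (inj₁ va) (inj₁ vb) _         = inj₁ (Consecutive-next-unique u va vb)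
  Adj-atMostTwo u a b c (inj₂ av) (inj₂ bv) _         = inj₁ (Consecutive-prev-unique u av bv)
  Adj-atMostTwo u a b c (inj₁ va) (inj₂ _)  (inj₁ vc) = inj₂ (inj₁ (Consecutive-next-unique u va vc))
  Adj-atMostTwo u a b c (inj₁ _)  (inj₂ bv) (inj₂ cv) = inj₂ (inj₂ (Consecutive-prev-unique u bv cv))
  Adj-atMostTwo u a b c (inj₂ _)  (inj₁ vb) (inj₁ vc) = inj₂ (inj₂ (Consecutive-next-unique u vb vc))
  Adj-atMostTwo u a b c (inj₂ av) (inj₁ _)  (inj₂ cv) = inj₂ (inj₁ (Consecutive-prev-unique u av cv))

module _ {m : ℕ} where

  upper : (Fin m → Fin m → ℕ) → Fin m → Fin m → ℕ
  upper w i j = if toℕ i <ᵇ toℕ j then w i j else 0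

  Crosses : (Fin m → Bool) → (Fin m → Fin m → Bool) → Set
  Crosses S F = ∀ i j → toℕ i < toℕ j → F i j ≡ true →
    (S i ≡ true × S j ≡ false) ⊎ (S i ≡ false × S j ≡ true)

  NoEdgeWithin : (Fin m → Bool) → (Fin m → Fin m → Bool) → Set
  NoEdgeWithin S F = ∀ i j → toℕ i < toℕ j → F i j ≡ true → S i ∧ S j ≡ false

  IsMatching : (Fin m → Fin m → Bool) → Set
  IsMatching F = ∀ i j k l → toℕ i < toℕ j → toℕ k < toℕ l → F i j ≡ true → F k l ≡ true →
    (i ≢ k ⊎ j ≢ l) → (i ≢ k × i ≢ l × j ≢ k × j ≢ l)

  inside-and-cut-≤-ends : ∀ {H H′ : Fin m → Bool} {F} →
    (∀ v → H′ v ≡ true → H v ≡ true) → Crosses H′ F → NoEdgeWithin H F →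
    ∀ w i j → onEdges (λ i j → H i ∧ H j) w i j + onEdges (λ i j → H i ∧ H j) w i j + onEdges F w i j
              ≤ (if H i then upper w i j else 0) + (if H j then upper w i j else 0)
  inside-and-cut-≤-ends {H} {H′} {F} H′⊆H crosses within w i j
    with toℕ i <ᵇ toℕ j | <ᵇ-reflects-< (toℕ i) (toℕ j)
  ... | false | _       = z≤n
  ... | true  | ofʸ i<j = go (H i) (H j) (F i j) (within i j i<j) end-in-H
    where
    end-in-H : F i j ≡ true → H i ≡ true ⊎ H j ≡ true
    end-in-H Fij with crosses i j i<j Fij
    ... | inj₁ (H′i , _) = inj₁ (H′⊆H i H′i)
    ... | inj₂ (_ , H′j) = inj₂ (H′⊆H j H′j)
    go : ∀ a b c → (c ≡ true → a ∧ b ≡ false) → (c ≡ true → a ≡ true ⊎ b ≡ true) →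
      (if a ∧ b then w i j else 0) + (if a ∧ b then w i j else 0) + (if c then w i j else 0)
      ≤ (if a then w i j else 0) + (if b then w i j else 0)
    go true  true  true  ¬both _ with ¬both refl
    ... | ()
    go true  true  false _ _ = ≤-reflexive (+-identityʳ (w i j + w i j))
    go true  false true  _ _ = ≤-reflexive (sym (+-identityʳ (w i j)))
    go true  false false _ _ = z≤n
    go false true  true  _ _ = ≤-refl
    go false true  false _ _ = z≤n
    go false false true  _ end with end refl
    ... | inj₁ ()
    ... | inj₂ ()
    go false false false _ _ = z≤n

  cut-≤-ends : ∀ {H′ : Fin m → Bool} {F} → Crosses H′ F →
    ∀ w → (∀ i j → toℕ i < toℕ j → w i j ≤ 1) → ∀ i j →
    onEdges F w i j ≤ (if H′ i then onEdges F (λ _ _ → 1) i j else 0)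
                      + (if H′ j then onEdges F (λ _ _ → 1) i j else 0)
  cut-≤-ends {F = F} crosses w w≤1 i j with toℕ i <ᵇ toℕ j | <ᵇ-reflects-< (toℕ i) (toℕ j)
  ... | false | _ = z≤n
  ... | true  | ofʸ i<j with F i j in Fij
  ...   | false = z≤n
  ...   | true with crosses i j i<j Fij
  ...     | inj₁ (H′i , H′j) rewrite H′i | H′j = w≤1 i j i<j
  ...     | inj₂ (H′i , H′j) rewrite H′i | H′j = w≤1 i j i<j

  onEdges-indicator : (F : Fin m → Fin m → Bool) →
    EdgeIndicator (onEdges F (λ _ _ → 1)) (λ i j → F i j ≡ true)
  onEdges-indicator F i j with toℕ i <ᵇ toℕ j | <ᵇ-reflects-< (toℕ i) (toℕ j)
  ... | false | _ = inj₁ refl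
  ... | true  | ofʸ i<j with F i j
  ...   | false = inj₁ refl
  ...   | true  = inj₂ (refl , i<j , refl)

  IsMatching⇒atMostOne : ∀ {F} → IsMatching F → ∀ v → AtMostOne (Incident (λ i j → F i j ≡ true) v)
  IsMatching⇒atMostOne matching v a b (inj₁ (v<a , Fva)) (inj₁ (v<b , Fvb)) with a ≟ᶠ b
  ... | yes a≡b = a≡b
  ... | no  a≢b = ⊥-elim (proj₁ (matching v a v b v<a v<b Fva Fvb (inj₂ a≢b)) refl)
  IsMatching⇒atMostOne matching v a b (inj₁ (v<a , Fva)) (inj₂ (b<v , Fbv)) =
    ⊥-elim (proj₁ (proj₂ (matching v a b v v<a b<v Fva Fbv (inj₁ (≢-sym (<⇒≢ b<v))))) refl)
  IsMatching⇒atMostOne matching v a b (inj₂ (a<v , Fav)) (inj₁ (v<b , Fvb)) =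
    ⊥-elim (proj₁ (proj₂ (proj₂ (matching a v v b a<v v<b Fav Fvb (inj₁ (<⇒≢ a<v))))) refl)
  IsMatching⇒atMostOne matching v a b (inj₂ (a<v , Fav)) (inj₂ (b<v , Fbv)) with a ≟ᶠ b
  ... | yes a≡b = a≡b
  ... | no  a≢b = ⊥-elim (proj₂ (proj₂ (proj₂ (matching a v b v a<v b<v Fav Fbv (inj₁ a≢b)))) refl)

  sumE-cut≤card : ∀ {H′ : Fin m → Bool} {F} (w : Fin m → Fin m → ℕ) →
    (∀ i j → toℕ i < toℕ j → w i j ≤ 1) → Crosses H′ F → IsMatching F → sumE F w ≤ card H′
  sumE-cut≤card {H′} {F} w w≤1 crosses matching = begin
    sumE F w
      ≡⟨ sumE-as-∑∑ F w ⟩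
    ∑∑ (onEdges F w)
      ≤⟨ ∑∑-mono-≤ (cut-≤-ends crosses w w≤1) ⟩
    ∑∑ (λ i j → (if H′ i then F₁ i j else 0) + (if H′ j then F₁ i j else 0))
      ≡⟨ ∑∑-ends≡∑-degree H′ F₁ ⟩
    ∑[ v < m ] (if H′ v then degree F₁ v else 0)
      ≤⟨ ∑-mono-≤ (λ v → if-mono-≤ (H′ v) (λ _ →
           degree-≤1 (onEdges-indicator F) v (IsMatching⇒atMostOne matching v))) ⟩
    ∑[ v < m ] (if H′ v then 1 else 0)
      ≡⟨ sym (sumV-as-∑ H′ (λ _ → 1)) ⟩
    card H′ ∎
    where
    open ≤-Reasoning
    F₁ : Fin m → Fin m → ℕ
    F₁ = onEdges F (λ _ _ → 1)

module TruckPath {n Vd x y} (feasible : Feasible n Vd x y) where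
  open Feasible feasible

  path : List (Vtx n)
  path = depot ∷ interior ++ [ depot' ]

  x≤1 : ∀ i j → toℕ i < toℕ j → x i j ≤ 1
  x≤1 i j i<j with x-path i j i<j
  ... | inj₁ (x≡1 , _) = ≤-reflexive x≡1
  ... | inj₂ (x≡0 , _) = subst (_≤ 1) (sym x≡0) z≤n

  upper-x-indicator : EdgeIndicator (upper x) (Adj path)
  upper-x-indicator i j with toℕ i <ᵇ toℕ j | <ᵇ-reflects-< (toℕ i) (toℕ j)
  ... | false | _ = inj₁ refl
  ... | true  | ofʸ i<j with x-path i j i<j
  ...   | inj₁ (x≡1 , adj) = inj₂ (x≡1 , i<j , adj)
  ...   | inj₂ (x≡0 , _)   = inj₁ x≡0

  y≡0⇒∉path : ∀ v → IsCustomer v → y v ≡ 0 → v ∉ path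
  y≡0⇒∉path v (0<v , _) _ (here refl) = <-irrefl refl 0<v
  y≡0⇒∉path v customer y≡0 (there v∈) with ∈-++⁻ interior v∈
  ... | inj₁ v∈interior with trans (sym y≡0) (proj₂ (interior-y v customer) v∈interior)
  ...   | ()
  y≡0⇒∉path v (_ , v<1+n) _ (there v∈) | inj₂ (here refl) =
    <-irrefl (toℕ-fromℕ (suc n)) v<1+n

  Incident⇒Adj : ∀ {v u} → Incident (Adj path) v u → Adj path v u
  Incident⇒Adj (inj₁ (_ , vu)) = vu
  Incident⇒Adj (inj₂ (_ , uv)) = Adj-sym uv

  degree≤2y : ∀ v → IsCustomer v → degree (upper x) v ≤ y v + y v
  degree≤2y v customer with y-binary v
  ... | inj₁ y≡0 rewrite y≡0 = degree-≤0 upper-x-indicator v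
          (λ u vu → y≡0⇒∉path v customer y≡0 (Adj⇒∈ (Incident⇒Adj vu)))
  ... | inj₂ y≡1 rewrite y≡1 = degree-≤2 upper-x-indicator v
          (λ a b c va vb vc →
            Adj-atMostTwo simple a b c (Incident⇒Adj va) (Incident⇒Adj vb) (Incident⇒Adj vc))

  inside-and-cut-bound : ∀ {H H′ : Vtx n → Bool} {F} → (∀ v → H v ≡ true → IsCustomer v) →
    (∀ v → H′ v ≡ true → H v ≡ true) → Crosses H′ F → NoEdgeWithin H F →
    sumE (λ i j → H i ∧ H j) x + sumE (λ i j → H i ∧ H j) x + sumE F x ≤ sumV H y + sumV H y
  inside-and-cut-bound {H} {H′} {F} H⊆Vc H′⊆H crosses within = begin
    sumE HH x + sumE HH x + sumE F x
      ≡⟨ cong₂ _+_ (cong₂ _+_ (sumE-as-∑∑ HH x) (sumE-as-∑∑ HH x)) (sumE-as-∑∑ F x) ⟩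
    ∑∑ I + ∑∑ I + ∑∑ C
      ≡⟨ sym (trans (∑∑-distrib-+ (λ i j → I i j + I i j) C)
                    (cong (_+ ∑∑ C) (∑∑-distrib-+ I I))) ⟩
    ∑∑ (λ i j → I i j + I i j + C i j)
      ≤⟨ ∑∑-mono-≤ (inside-and-cut-≤-ends H′⊆H crosses within x) ⟩
    ∑∑ (λ i j → (if H i then upper x i j else 0) + (if H j then upper x i j else 0))
      ≡⟨ ∑∑-ends≡∑-degree H (upper x) ⟩
    ∑[ v < m ] (if H v then degree (upper x) v else 0)
      ≤⟨ ∑-mono-≤ (λ v → if-mono-≤ (H v) (degree≤2y v ∘ H⊆Vc v)) ⟩
    ∑[ v < m ] (if H v then y v + y v else 0)
      ≡⟨ sum-cong-≗ (λ v → sym (if-+ (H v) (y v) (y v))) ⟩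
    ∑[ v < m ] ((if H v then y v else 0) + (if H v then y v else 0))
      ≡⟨ ∑-distrib-+ (λ v → if H v then y v else 0) (λ v → if H v then y v else 0) ⟩
    ∑[ v < m ] (if H v then y v else 0) + ∑[ v < m ] (if H v then y v else 0)
      ≡⟨ sym (cong₂ _+_ (sumV-as-∑ H y) (sumV-as-∑ H y)) ⟩
    sumV H y + sumV H y ∎
    where
    open ≤-Reasoning
    m : ℕ
    m = suc (suc n)
    HH : Vtx n → Vtx n → Bool
    HH i j = H i ∧ H j
    I C : Vtx n → Vtx n → ℕ
    I = onEdges HH x
    C = onEdges F x

m+m≤1+n+n⇒m≤n : ∀ m n → m + m ≤ suc (n + n) → m ≤ n
m+m≤1+n+n⇒m≤n zero    n       _ = z≤n
m+m≤1+n+n⇒m≤n (suc m) zero    (s≤s m+1+m≤0) rewrite +-suc m m with m+1+m≤0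
... | ()
m+m≤1+n+n⇒m≤n (suc m) (suc n) (s≤s p) rewrite +-suc m m | +-suc n n =
  s≤s (m+m≤1+n+n⇒m≤n m n (≤-pred p))

halve-≤ : ∀ a b s k → a + a + b ≤ s + s → b ≤ 2 * k + 1 → a + b ≤ s + k
halve-≤ a b s k p q = m+m≤1+n+n⇒m≤n (a + b) (s + k) (begin
  (a + b) + (a + b)   ≡⟨ solve (a ∷ b ∷ []) ⟩
  (a + a + b) + b     ≤⟨ +-mono-≤ p q ⟩
  (s + s) + (2 * k + 1) ≡⟨ solve (s ∷ k ∷ []) ⟩
  suc ((s + k) + (s + k)) ∎)
  where open ≤-Reasoning

[2k+1∸1]/2≡k : ∀ k → (2 * k + 1 ∸ 1) / 2 ≡ k
[2k+1∸1]/2≡k k = trans (cong (_/ 2) (trans (m+n∸n≡m (2 * k) 1) (*-comm 2 k))) (m*n/n≡m k 2)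

proposition6 : (n : ℕ) (Vd : Vtx n → Bool) (x : Vtx n → Vtx n → ℕ) (y : Vtx n → ℕ)
    (H H' : Vtx n → Bool) (E' : Vtx n → Vtx n → Bool) →
    Feasible n Vd x y →
    (∀ v → H v ≡ true → IsCustomer v) →
    (∀ v → H' v ≡ true → H v ≡ true) →
    3 ≤ card H' →
    (∃ λ k → card H' ≡ 2 * k + 1) →
    (∀ i j → toℕ i < toℕ j → E' i j ≡ true →
       (H' i ≡ true × H' j ≡ false) ⊎ (H' i ≡ false × H' j ≡ true)) →
    (∀ v → H' v ≡ true →
       ∃ λ w → ((toℕ v < toℕ w) × E' v w ≡ true) ⊎ ((toℕ w < toℕ v) × E' w v ≡ true)) →
    (∀ i j → toℕ i < toℕ j → E' i j ≡ true → H i ∧ H j ≡ false) →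
    (∀ i j k l → toℕ i < toℕ j → toℕ k < toℕ l → E' i j ≡ true → E' k l ≡ true →
       (i ≢ k ⊎ j ≢ l) → (i ≢ k × i ≢ l × j ≢ k × j ≢ l)) →
    sumE (λ i j → H i ∧ H j) x + sumE E' x ≤ sumV H y + (card H' ∸ 1) / 2
proposition6 n Vd x y H H' E' feasible H⊆Vc H'⊆H _ (k , |H'|≡2k+1) crosses _ within matching = begin
  sumE (λ i j → H i ∧ H j) x + sumE E' x
    ≤⟨ halve-≤ (sumE (λ i j → H i ∧ H j) x) (sumE E' x) (sumV H y) k
         (inside-and-cut-bound H⊆Vc H'⊆H crosses within) cut≤2k+1 ⟩
  sumV H y + k
    ≡⟨ cong (sumV H y +_) (sym (trans (cong (λ c → (c ∸ 1) / 2) |H'|≡2k+1) ([2k+1∸1]/2≡k k))) ⟩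
  sumV H y + (card H' ∸ 1) / 2 ∎
  where
  open ≤-Reasoning
  open TruckPath feasible
  cut≤2k+1 : sumE E' x ≤ 2 * k + 1
  cut≤2k+1 = subst (sumE E' x ≤_) |H'|≡2k+1 (sumE-cut≤card x x≤1 crosses matching)
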